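{- Let $s(n)=\sum_{k\ge 0}\operatorname{bit}_k(n+k)2^k$ for $n\ge 0$, let $t(1)<t(2)<t(3)<\cdots$ be the nonnegative integers not of the form $s(n)$ ($n\ge 0$), listed in increasing order, and let $d(n)=\sum_{k=0}^{n}\operatorname{bit}_k(n-k)2^k$ for $n\ge0$. Then: (i) For $n\ge 0$, $$ t(n+1)=2^n-\tfrac12+\tfrac12\sum_{k=0}^{n}(-1)^{\lfloor (n-k)/2^k\rfloor}\,2^k. $$ (ii) $t(1)=1$, $t(2)=2$, and for all integers $i\ge 1$ and $i\le j\le 2^i+i$, $$ t(2^i+j)=\begin{cases} 2^{2^i+i}-2^i+t(i) & \text{if } j=i,\\ 2^{2^i+j}-2^i-2^j+t(j) & \text{if } i<j\le 2^i+i.\end{cases} $$ (iii) For $n\ge 1$, $$ t(n)=-n+\sum_{k\ge 1,\; n-k\equiv 0\pmod{2^k}} 2^k. $$ (iv) For $n\ge 1$, $t(n)=2^n-1-d(n-1)$. (v) If $s$ is extended to all integers $n$ by $s(n)=n+\sum_{k\ge 1,\; n+k\equiv 0 \pmod{2^k}}2^k$ (a finite sum for every integer $n$), then $t(n)=s(-n)$ for all $n\ge 1$.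
   Context: For integers $m\ge 0$ and $k\ge 0$, $\operatorname{bit}_k(m)=\lfloor m/2^k\rfloor \bmod 2$ is the coefficient of $2^k$ in the binary expansion of $m$. The sequence $s$ (sloping binary numbers, obtained by reading right-justified binary expansions of $0,1,2,\dots$ along upward-sloping diagonals) begins $0,3,6,5,4,15,10,\dots$; the missing values $t(n)$ begin $1,2,7,12,29,62,\dots$. For $n\ge 0$ one has $s(n)=n+\sum_{k\ge1,\,n+k\equiv0\pmod{2^k}}2^k$, so the extension in (v) agrees with $s$ on $n\ge 0$. -}

module Defs where

open import Data.Nat as ℕ using (ℕ; zero; suc; _^_; _/_; _%_; _≤_; _<_)
open import Data.Nat.Divisibility using (_∣?_)
open import Data.Integer as ℤ using (ℤ; +_; ∣_∣)
open import Data.Nat.Properties using (m^n>0)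
open import Data.Bool using (if_then_else_)
open import Data.Product using (Σ; ∃; _×_)
open import Relation.Nullary using (¬_; ⌊_⌋)
open import Relation.Binary.PropositionalEquality using (_≡_)

bit : ℕ → ℕ → ℕ
bit k m = (m / (2 ^ k)) {{ℕ.>-nonZero (m^n>0 2 k)}} % 2

sumℕ : ℕ → (ℕ → ℕ) → ℕ
sumℕ zero    f = f 0
sumℕ (suc n) f = sumℕ n f ℕ.+ f (suc n)

sum0 : ℕ → (ℕ → ℤ) → ℤ
sum0 zero    f = f 0
sum0 (suc n) f = sum0 n f ℤ.+ f (suc n)

sum1 : ℕ → (ℕ → ℤ) → ℤ
sum1 zero    f = + 0
sum1 (suc n) f = sum1 n f ℤ.+ f (suc n)

-- s(n) = Σ_{k≥0} bit_k(n+k) 2^k.  Terms with k > n vanish (n+k < 2k ≤ 2^k),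
-- so the sum is taken over 0 ≤ k ≤ n.
s : ℕ → ℕ
s n = sumℕ n (λ k → bit k (n ℕ.+ k) ℕ.* 2 ^ k)

d : ℕ → ℕ
d n = sumℕ n (λ k → bit k (n ℕ.∸ k) ℕ.* 2 ^ k)

Missing : ℕ → Set
Missing m = ¬ (Σ ℕ (λ n → s n ≡ m))

-- t (indexed from 1; the value t 0 is irrelevant) lists the missing values
-- in strictly increasing order: strictly increasing on indices ≥ 1, and its
-- image on indices ≥ 1 is exactly the set of missing values.
IsListing : (ℕ → ℕ) → Set
IsListing t =
  ((k : ℕ) → 1 ≤ k → t k < t (suc k)) ×
  ((m : ℕ) → (Missing m → ∃ (λ k → 1 ≤ k × t k ≡ m)) ×
             (∃ (λ k → 1 ≤ k × t k ≡ m) → Missing m))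

pow2 : ℕ → ℤ
pow2 k = + (2 ^ k)

signedTerm : ℕ → ℕ → ℤ
signedTerm n k =
  if ⌊ 2 ∣? ((n ℕ.∸ k) / (2 ^ k)) {{ℕ.>-nonZero (m^n>0 2 k)}} ⌋
  then pow2 k else ℤ.- pow2 k

-- 2^k if 2^k divides the integer x, else 0
-- (integer divisibility a ∣ x is ∣a∣ ∣ ∣x∣, as in Data.Integer.Divisibility)
divTerm : ℤ → ℕ → ℤ
divTerm x k = if ⌊ (2 ^ k) ∣? ∣ x ∣ ⌋ then pow2 k else + 0

-- Extension of s to all integers:
-- s(n) = n + Σ_{k≥1, n+k ≡ 0 mod 2^k} 2^k.  For k > |n| one has
-- 0 < |n+k| < 2^k, so only 1 ≤ k ≤ |n| contribute.
sExt : ℤ → ℤ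
sExt n = n ℤ.+ sum1 ∣ n ∣ (λ k → divTerm (n ℤ.+ + k) k)

-- The binary digits of s(a) are bit_k(a + k), while T(c + 1) := 2^(c+1) − 1 − d(c) has the
-- digits 1 − bit_k(c − k), k ≤ c. If 2^j exactly divides b − a > 0, then a + j and b + j differ
-- at bit j, so s is injective. If 2^j exactly divides a + c + 1, then bit j of a + j equals
-- bit j of c − j when j ≤ c and is 1 when j > c; either way s(a) ≠ T(c + 1). As T is
-- increasing and s(a) < 2^N once a + N < 2^N, the N values T(1..N) and the 2^N − N values
-- s(0..2^N − N − 1) fill [0, 2^N), so N itself is a value of s or of T: T lists the missing
-- values. (i) and (iv) restate T(c + 1) + d(c) + 1 = 2^(c+1). A carry invariant gives
-- d(c) + Σ_{1≤k≤c, 2^k ∣ c+1−k} 2^k = c, which is (iii); (v) is (iii) up to |−x| = |x|, and (ii)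
-- follows from (iii) since for n = 2^i + j only the terms with k ≤ i or k = n survive.

module Submission where

open import Defs
open import Data.Nat as ℕ
  using (ℕ; zero; suc; _+_; _*_; _∸_; _^_; _≤_; _<_; z≤n; s≤s; NonZero; _/_; _%_; _<?_; _≤?_)
open import Data.Nat.Properties
open import Data.Nat.DivMod
open import Data.Nat.Divisibility
  using (_∣_; _∣?_; divides; n∣m*n; ∣m+n∣m⇒∣n; ∣m∣n⇒∣m+n; ∣⇒≤; n∣m⇒m%n≡0; m%n≡0⇒n∣m)
open import Data.Nat.Induction using (<-rec)
open import Data.Nat.Tactic.RingSolver using (solve-∀)
open import Data.Integer as ℤ using (ℤ; +_; -_; _-_; ∣_∣)
import Data.Integer.Properties as ℤ
import Data.Integer.Tactic.RingSolver as ℤ-Solver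
open import Data.Product using (Σ; ∃; ∃₂; _×_; _,_; proj₁; proj₂)
open import Data.Fin as Fin using (Fin; toℕ; fromℕ<; punchOut)
open import Data.Fin.Properties
  using (toℕ<n; toℕ-fromℕ<; toℕ-injective; injective⇒≤; punchOut-injective; any?)
open import Function.Base using (_∋_)
open import Function.Definitions using (Injective)
open import Relation.Binary.Definitions using (tri<; tri≈; tri>)
open import Data.Sum using (_⊎_; inj₁; inj₂)
open import Data.Bool using (true; false; if_then_else_)
open import Relation.Nullary using (¬_; yes; no; contradiction; ⌊_⌋)
open import Relation.Binary.PropositionalEquality

2^-nonZero : ∀ k → NonZero (2 ^ k)
2^-nonZero k = ℕ.>-nonZero (m^n>0 2 k)

-- An instance NonZero (2 ^ k) would make instance search for NonZero 2 ambiguous, so division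
-- by 2 ^ k carries its proof explicitly; bit j x unfolds to x /2^ j % 2.
infixl 7 _/2^_ _%2^_

_/2^_ : ℕ → ℕ → ℕ
x /2^ k = (x / 2 ^ k) {{2^-nonZero k}}

_%2^_ : ℕ → ℕ → ℕ
x %2^ k = (x % 2 ^ k) {{2^-nonZero k}}

2^n<2^[1+n] : ∀ n → 2 ^ n < 2 ^ suc n
2^n<2^[1+n] n = ^-monoʳ-< 2 (s≤s (s≤s z≤n)) (n<1+n n)

n<2^n : ∀ n → n < 2 ^ n
n<2^n zero    = s≤s z≤n
n<2^n (suc n) = ≤-trans (s≤s (n<2^n n)) (2^n<2^[1+n] n)

m<n⇒m+n<2^n : ∀ {m n} → m < n → m + n < 2 ^ n
m<n⇒m+n<2^n {m} {suc n} m<n = begin-strict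
  m + suc n           <⟨ +-monoˡ-< (suc n) m<n ⟩
  suc n + suc n       ≤⟨ +-mono-≤ (n<2^n n) (n<2^n n) ⟩
  2 ^ n + 2 ^ n       ≡⟨ cong (_+_ (2 ^ n)) (+-identityʳ (2 ^ n)) ⟨
  2 ^ suc n           ∎
  where open ≤-Reasoning

^-monoʳ-∣ : ∀ m {k i} → k ≤ i → m ^ k ∣ m ^ i
^-monoʳ-∣ m {k} {i} k≤i =
  divides (m ^ (i ∸ k)) (trans (cong (m ^_) (sym (m∸n+n≡m k≤i))) (^-distribˡ-+-* m (i ∸ k) k))

[1+n]%2≢n%2 : ∀ n → suc n % 2 ≢ n % 2
[1+n]%2≢n%2 zero          ()
[1+n]%2≢n%2 (suc zero)    ()
[1+n]%2≢n%2 (suc (suc n)) = [1+n]%2≢n%2 n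

m+n≡q*2⇒m%2≡n%2 : ∀ m n q → m + n ≡ q * 2 → m % 2 ≡ n % 2
m+n≡q*2⇒m%2≡n%2 m n q m+n≡2q = begin
  m % 2                 ≡⟨ [m+kn]%n≡m%n m q 2 ⟨
  (m + q * 2) % 2       ≡⟨ cong (λ x → (m + x) % 2) m+n≡2q ⟨
  (m + (m + n)) % 2     ≡⟨ cong (_% 2) (rearrange m n) ⟩
  (n + m * 2) % 2       ≡⟨ [m+kn]%n≡m%n n m 2 ⟩
  n % 2                 ∎
  where
  open ≡-Reasoning
  rearrange : ∀ m n → m + (m + n) ≡ n + m * 2
  rearrange = solve-∀

2∤n⇒n%2≡1 : ∀ n → ¬ 2 ∣ n → n % 2 ≡ 1
2∤n⇒n%2≡1 n 2∤n with n % 2 | m%n<n n 2 | m%n≡0⇒n∣m n 2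
... | 0           | _             | 2∣n = contradiction (2∣n refl) 2∤n
... | 1           | _             | _   = refl
... | suc (suc _) | s≤s (s≤s ()) | _

multiple-below-double : ∀ {m n} → m ∣ n → 0 < n → n < m + m → n ≡ m
multiple-below-double     (divides 0 refl)             ()
multiple-below-double {m} (divides 1 refl)             _ _    = +-identityʳ m
multiple-below-double {m} (divides (suc (suc k)) refl) _ n<2m =
  contradiction n<2m (≤⇒≯ (+-monoʳ-≤ m (m≤m+n m (k * m))))

suc≡odd*2^ : ∀ n → ∃₂ λ j q → suc n ≡ suc (q * 2) * 2 ^ j
suc≡odd*2^ = <-rec _ split
  where
  shift : ∀ a b → a * b * 2 ≡ a * (2 * b)
  shift = solve-∀
  split : ∀ n → (∀ {m} → m < n → ∃₂ λ j q → suc m ≡ suc (q * 2) * 2 ^ j) →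
          ∃₂ λ j q → suc n ≡ suc (q * 2) * 2 ^ j
  split n rec with n % 2 | m≡m%n+[m/n]*n n 2 | m%n<n n 2
  ... | 0           | n≡2h   | _ = 0 , n / 2 , trans (cong suc n≡2h) (sym (*-identityʳ _))
  ... | 1           | n≡2h+1 | _ with rec {n / 2} (subst (n / 2 <_) (sym n≡2h+1) (s≤s (m≤m*n (n / 2) 2)))
  ...   | j , q , h+1≡ = suc j , q , (begin
    suc n                         ≡⟨ cong suc n≡2h+1 ⟩
    suc (n / 2) * 2               ≡⟨ cong (_* 2) h+1≡ ⟩
    suc (q * 2) * 2 ^ j * 2       ≡⟨ shift (suc (q * 2)) (2 ^ j) ⟩
    suc (q * 2) * 2 ^ suc j       ∎)
    where open ≡-Reasoning
  split n rec | suc (suc _) | _ | s≤s (s≤s ())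

bit≤1 : ∀ j x → bit j x ≤ 1
bit≤1 j x = ℕ.≤-pred (m%n<n (x /2^ j) 2)

bit-small : ∀ j {x} → x < 2 ^ j → bit j x ≡ 0
bit-small j x<2^j = cong (_% 2) (m<n⇒m/n≡0 x<2^j)
  where instance _ = 2^-nonZero j

bit-+-* : ∀ j x m → bit j (x + m * 2 ^ j) ≡ (x /2^ j + m) % 2
bit-+-* j x m = cong (_% 2) (begin
  (x + m * 2 ^ j) / 2 ^ j          ≡⟨ +-distrib-/-∣ʳ x (n∣m*n m) ⟩
  x / 2 ^ j + m * 2 ^ j / 2 ^ j    ≡⟨ cong (_+_ (x / 2 ^ j)) (m*n/n≡m m (2 ^ j)) ⟩
  x / 2 ^ j + m                    ∎)
  where
  open ≡-Reasoning
  instance _ = 2^-nonZero j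

bit-low : ∀ j {r} m → r < 2 ^ j → bit j (r + m * 2 ^ j) ≡ m % 2
bit-low j {r} m r<2^j = trans (bit-+-* j r m) (cong (λ x → (x + m) % 2) (m<n⇒m/n≡0 r<2^j))
  where instance _ = 2^-nonZero j

bit-+-even : ∀ j x q → bit j (x + q * 2 * 2 ^ j) ≡ bit j x
bit-+-even j x q = trans (bit-+-* j x (q * 2)) ([m+kn]%n≡m%n (x /2^ j) q 2)

bit-+-odd : ∀ j x q → bit j (x + suc (q * 2) * 2 ^ j) ≢ bit j x
bit-+-odd j x q flipped = [1+n]%2≢n%2 (x /2^ j) (begin
  suc (x /2^ j) % 2                  ≡⟨ [m+kn]%n≡m%n (suc (x /2^ j)) q 2 ⟨
  (suc (x /2^ j) + q * 2) % 2        ≡⟨ cong (_% 2) (sym (+-suc (x /2^ j) (q * 2))) ⟩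
  (x /2^ j + suc (q * 2)) % 2        ≡⟨ bit-+-* j x (suc (q * 2)) ⟨
  bit j (x + suc (q * 2) * 2 ^ j)    ≡⟨ flipped ⟩
  bit j x                            ∎)
  where open ≡-Reasoning

bit-+-*2^> : ∀ {j k} x m → j < k → bit j (x + m * 2 ^ k) ≡ bit j x
bit-+-*2^> {j} {k} x m j<k =
  trans (cong (λ y → bit j (x + y)) m*2^k≡) (bit-+-even j x (m * 2 ^ (k ∸ suc j)))
  where
  open ≡-Reasoning
  reassoc : ∀ m a b → m * (a * (2 * b)) ≡ m * a * 2 * b
  reassoc = solve-∀
  m*2^k≡ : m * 2 ^ k ≡ m * 2 ^ (k ∸ suc j) * 2 * 2 ^ j
  m*2^k≡ = begin
    m * 2 ^ k                              ≡⟨ cong (λ e → m * 2 ^ e) (sym (m∸n+n≡m j<k)) ⟩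
    m * 2 ^ (k ∸ suc j + suc j)            ≡⟨ cong (m *_) (^-distribˡ-+-* 2 (k ∸ suc j) (suc j)) ⟩
    m * (2 ^ (k ∸ suc j) * (2 * 2 ^ j))    ≡⟨ reassoc m (2 ^ (k ∸ suc j)) (2 ^ j) ⟩
    m * 2 ^ (k ∸ suc j) * 2 * 2 ^ j        ∎

-- The low parts of x and y add up to 2^j − 1, so no carry reaches bit j.
bit-complement : ∀ j x y q → x + y + 1 ≡ suc (q * 2) * 2 ^ j → bit j x ≡ bit j y
bit-complement j x y q x+y+1≡ = m+n≡q*2⇒m%2≡n%2 x₁ y₁ q quotients
  where
  instance _ = 2^-nonZero j
  P = 2 ^ j
  x₀ = x %2^ j
  x₁ = x /2^ j
  y₀ = y %2^ j
  y₁ = y /2^ j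
  low = x₀ + y₀ + 1
  regroup : ∀ a b c d P → a + b * P + (c + d * P) + 1 ≡ a + c + 1 + (b + d) * P
  regroup = solve-∀
  split : low + (x₁ + y₁) * P ≡ suc (q * 2) * P
  split = begin
    low + (x₁ + y₁) * P                 ≡⟨ regroup x₀ x₁ y₀ y₁ P ⟨
    x₀ + x₁ * P + (y₀ + y₁ * P) + 1     ≡⟨ cong₂ (λ a b → a + b + 1) (m≡m%n+[m/n]*n x P)
                                                                     (m≡m%n+[m/n]*n y P) ⟨
    x + y + 1                           ≡⟨ x+y+1≡ ⟩
    suc (q * 2) * P                     ∎
    where open ≡-Reasoning
  low<2P : low < P + P
  low<2P = subst (_< P + P) (+-comm 1 (x₀ + y₀)) (+-mono-≤-< (m%n<n x P) (m%n<n y P))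
  P∣low : P ∣ low
  P∣low = ∣m+n∣m⇒∣n (subst (P ∣_) (trans (sym split) (+-comm low _)) (n∣m*n (suc (q * 2))))
                     (n∣m*n (x₁ + y₁))
  low≡P : low ≡ P
  low≡P = multiple-below-double P∣low (subst (0 <_) (+-comm 1 (x₀ + y₀)) (s≤s z≤n)) low<2P
  quotients : x₁ + y₁ ≡ q * 2
  quotients = *-cancelʳ-≡ _ _ P (+-cancelˡ-≡ P _ _ (trans (cong (_+ (x₁ + y₁) * P) (sym low≡P)) split))

%2^-suc : ∀ k m → m %2^ suc k ≡ m %2^ k + bit k m * 2 ^ k
%2^-suc k m = begin
  x                           ≡⟨ m≡m%n+[m/n]*n x (2 ^ k) ⟩
  x %2^ k + x /2^ k * 2 ^ k   ≡⟨ cong₂ (λ a b → a + b * 2 ^ k) (m∣n⇒o%n%m≡o%m (2 ^ k) (2 ^ suc k) m (n∣m*n 2))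
                                                                (m%[n*o]/o≡m/o%n m 2 (2 ^ k)) ⟩
  m %2^ k + bit k m * 2 ^ k   ∎
  where
  open ≡-Reasoning
  instance _ = 2^-nonZero k
           _ = 2^-nonZero (suc k)
  x = m %2^ suc k

numeral : ℕ → (ℕ → ℕ) → ℕ
numeral n c = sumℕ n (λ k → c k * 2 ^ k)

Binary : (ℕ → ℕ) → Set
Binary c = ∀ k → c k ≤ 1

numeral<2^ : ∀ {c} → Binary c → ∀ n → numeral n c < 2 ^ suc n
numeral<2^ b zero    = s≤s (*-monoˡ-≤ 1 (b 0))
numeral<2^ b (suc n) =
  +-mono-<-≤ (numeral<2^ b n) (*-monoˡ-≤ (2 ^ suc n) (b (suc n)))

numeral-<2^-vanishing : ∀ {c K} → Binary c → (∀ k → K ≤ k → c k ≡ 0) → ∀ n → numeral n c < 2 ^ K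
numeral-<2^-vanishing {c} {K} b vanish n with n <? K
... | yes n<K = <-≤-trans (numeral<2^ b n) (^-monoʳ-≤ 2 n<K)
numeral-<2^-vanishing {c} {K} b vanish zero    | no 0≮K =
  subst (λ x → x * 1 < 2 ^ K) (sym (vanish 0 (≮⇒≥ 0≮K))) (m^n>0 2 K)
numeral-<2^-vanishing {c} {K} b vanish (suc n) | no n+1≮K = begin-strict
  numeral n c + c (suc n) * 2 ^ suc n   ≡⟨ cong (λ x → numeral n c + x * 2 ^ suc n)
                                                (vanish (suc n) (≮⇒≥ n+1≮K)) ⟩
  numeral n c + 0                       ≡⟨ +-identityʳ _ ⟩
  numeral n c                           <⟨ numeral-<2^-vanishing b vanish n ⟩
  2 ^ K                                 ∎
  where open ≤-Reasoning

numeral-top≤ : ∀ c n → c n * 2 ^ n ≤ numeral n c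
numeral-top≤ c zero    = ≤-refl
numeral-top≤ c (suc n) = m≤n+m _ (numeral n c)

bit-numeral-top : ∀ {c} → Binary c → ∀ n → bit n (numeral n c) ≡ c n
bit-numeral-top {c} b zero    = trans (bit-low 0 (c 0) (s≤s z≤n)) (m<n⇒m%n≡m (s≤s (b 0)))
bit-numeral-top {c} b (suc n) =
  trans (bit-low (suc n) (c (suc n)) (numeral<2^ b n)) (m<n⇒m%n≡m (s≤s (b (suc n))))

bit-numeral : ∀ {c} → Binary c → ∀ {j n} → j ≤ n → bit j (numeral n c) ≡ c j
bit-numeral {c} b {j} {n} j≤n with m≤n⇒m<n∨m≡n j≤n
... | inj₂ refl = bit-numeral-top b j
bit-numeral {c} b {j} {suc n} _ | inj₁ (s≤s j≤n) =
  trans (bit-+-*2^> (numeral n c) (c (suc n)) (s≤s j≤n)) (bit-numeral b j≤n)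

bit-numeral-> : ∀ {c} → Binary c → ∀ {j n} → n < j → bit j (numeral n c) ≡ 0
bit-numeral-> b {j} {n} n<j = bit-small j (<-≤-trans (numeral<2^ b n) (^-monoʳ-≤ 2 n<j))

complementary-digits : ∀ {x} → x ≤ 1 → ∀ y → (1 ∸ x) * y + x * y ≡ y
complementary-digits {x} x≤1 y = begin
  (1 ∸ x) * y + x * y   ≡⟨ *-distribʳ-+ y (1 ∸ x) x ⟨
  (1 ∸ x + x) * y       ≡⟨ cong (_* y) (m∸n+n≡m x≤1) ⟩
  1 * y                 ≡⟨ *-identityˡ y ⟩
  y                     ∎
  where open ≡-Reasoning

numeral-complement : ∀ {c} → Binary c → ∀ n → numeral n (λ k → 1 ∸ c k) + numeral n c + 1 ≡ 2 ^ suc n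
numeral-complement {c} b zero    = cong (_+ 1) (complementary-digits (b 0) 1)
numeral-complement {c} b (suc n) = begin
  A + x * P + (B + y * P) + 1   ≡⟨ regroup A B (x * P) (y * P) ⟩
  (A + B + 1) + (x * P + y * P) ≡⟨ cong₂ _+_ (numeral-complement b n) (complementary-digits (b (suc n)) P) ⟩
  P + P                         ≡⟨ cong (_+_ P) (+-identityʳ P) ⟨
  2 ^ suc (suc n)               ∎
  where
  open ≡-Reasoning
  A = numeral n (λ k → 1 ∸ c k)
  B = numeral n c
  x = 1 ∸ c (suc n)
  y = c (suc n)
  P = 2 ^ suc n
  regroup : ∀ a b u v → a + u + (b + v) + 1 ≡ (a + b + 1) + (u + v)
  regroup = solve-∀

-- T lists the values missed by s

bit-s : ∀ a j → bit j (s a) ≡ bit j (a + j)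
bit-s a j with j ≤? a
... | yes j≤a = bit-numeral (λ k → bit≤1 k (a + k)) j≤a
... | no  j≰a = trans (bit-numeral-> (λ k → bit≤1 k (a + k)) a<j) (sym (bit-small j (m<n⇒m+n<2^n a<j)))
  where a<j = ≰⇒> j≰a

s-separates : ∀ {a b} → a < b → s a ≢ s b
s-separates {a} {b} a<b s≡ with j , q , gap+1≡ ← suc≡odd*2^ (b ∸ suc a) = bit-+-odd j (a + j) q (begin
  bit j (a + j + suc (q * 2) * 2 ^ j)   ≡⟨ cong (λ x → bit j (a + j + x)) gap+1≡ ⟨
  bit j (a + j + suc gap)               ≡⟨ cong (bit j) (reorder a j (suc gap)) ⟩
  bit j (a + suc gap + j)               ≡⟨ cong (λ x → bit j (x + j)) a+gap+1≡b ⟩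
  bit j (b + j)                         ≡⟨ bit-s b j ⟨
  bit j (s b)                           ≡⟨ cong (bit j) s≡ ⟨
  bit j (s a)                           ≡⟨ bit-s a j ⟩
  bit j (a + j)                         ∎)
  where
  open ≡-Reasoning
  gap = b ∸ suc a
  a+gap+1≡b : a + suc gap ≡ b
  a+gap+1≡b = trans (+-suc a gap) (m+[n∸m]≡n a<b)
  reorder : ∀ a j e → a + j + e ≡ a + e + j
  reorder = solve-∀

s-injective : ∀ {a b} → s a ≡ s b → a ≡ b
s-injective {a} {b} s≡ with <-cmp a b
... | tri< a<b _ _ = contradiction s≡ (s-separates a<b)
... | tri≈ _ a≡b _ = a≡b
... | tri> _ _ b<a = contradiction (sym s≡) (s-separates b<a)

s<2^ : ∀ {a K} → a + K < 2 ^ K → s a < 2 ^ K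
s<2^ {a} {K} a+K<2^K =
  numeral-<2^-vanishing (λ k → bit≤1 k (a + k)) (λ k K≤k → bit-small k (a+k<2^k (≤⇒≤′ K≤k))) a
  where
  a+k<2^k : ∀ {k} → K ℕ.≤′ k → a + k < 2 ^ k
  a+k<2^k ℕ.≤′-refl              = a+K<2^K
  a+k<2^k (ℕ.≤′-step {k} K≤′k) = begin-strict
    a + suc k      ≡⟨ +-suc a k ⟩
    suc (a + k)    ≤⟨ a+k<2^k K≤′k ⟩
    2 ^ k          <⟨ 2^n<2^[1+n] k ⟩
    2 ^ suc k      ∎
    where open ≤-Reasoning

-- T (suc c) = 2^(c+1) − 1 − d c by T+d+1≡2^; T 0 is junk, listings being indexed from 1.
T : ℕ → ℕ
T zero    = 0
T (suc c) = numeral c (λ k → 1 ∸ bit k (c ∸ k))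

complement-binary : ∀ c → Binary (λ k → 1 ∸ bit k (c ∸ k))
complement-binary c k = m∸n≤m 1 (bit k (c ∸ k))

bit-T : ∀ {j c} → j ≤ c → bit j (T (suc c)) ≡ 1 ∸ bit j (c ∸ j)
bit-T {c = c} = bit-numeral (complement-binary c)

bit-T-> : ∀ {j c} → c < j → bit j (T (suc c)) ≡ 0
bit-T-> {c = c} = bit-numeral-> (complement-binary c)

T<2^ : ∀ c → T (suc c) < 2 ^ suc c
T<2^ c = numeral<2^ (complement-binary c) c

2^≤T : ∀ c → 2 ^ c ≤ T (suc c)
2^≤T c = subst (_≤ T (suc c)) top-term (numeral-top≤ (λ k → 1 ∸ bit k (c ∸ k)) c)
  where
  top-term : (1 ∸ bit c (c ∸ c)) * 2 ^ c ≡ 2 ^ c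
  top-term = begin
    (1 ∸ bit c (c ∸ c)) * 2 ^ c   ≡⟨ cong (λ x → (1 ∸ bit c x) * 2 ^ c) (n∸n≡0 c) ⟩
    (1 ∸ bit c 0) * 2 ^ c         ≡⟨ cong (λ x → (1 ∸ x) * 2 ^ c) (bit-small c (m^n>0 2 c)) ⟩
    1 * 2 ^ c                     ≡⟨ *-identityˡ (2 ^ c) ⟩
    2 ^ c                         ∎
    where open ≡-Reasoning

T-step : ∀ k → 1 ≤ k → T k < T (suc k)
T-step (suc c) _ = <-≤-trans (T<2^ c) (2^≤T (suc c))

step⇒strictly-increasing : ∀ {t : ℕ → ℕ} → (∀ k → 1 ≤ k → t k < t (suc k)) →
                           ∀ {m n} → 1 ≤ m → m < n → t m < t n
step⇒strictly-increasing step {m} {suc n} 1≤m (s≤s m≤n) with m≤n⇒m<n∨m≡n m≤n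
... | inj₁ m<n  = <-trans (step⇒strictly-increasing step 1≤m m<n) (step n (≤-trans 1≤m m≤n))
... | inj₂ refl = step m 1≤m

T-injective : ∀ {a b} → T (suc a) ≡ T (suc b) → a ≡ b
T-injective {a} {b} T≡ with <-cmp a b
... | tri< a<b _ _ = contradiction T≡ (<⇒≢ (step⇒strictly-increasing T-step (s≤s z≤n) (s≤s a<b)))
... | tri≈ _ a≡b _ = a≡b
... | tri> _ _ b<a = contradiction (sym T≡) (<⇒≢ (step⇒strictly-increasing T-step (s≤s z≤n) (s≤s b<a)))

b≢1∸b : ∀ b → b ≢ 1 ∸ b
b≢1∸b zero          ()
b≢1∸b (suc zero)    ()
b≢1∸b (suc (suc b)) ()

s≢T : ∀ a c → s a ≢ T (suc c)
s≢T a c s≡T with j , q , a+c+1≡ ← suc≡odd*2^ (a + c) with j ≤? c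
... | yes j≤c = b≢1∸b (bit j (c ∸ j)) (begin
  bit j (c ∸ j)       ≡⟨ bit-complement j (a + j) (c ∸ j) q sum ⟨
  bit j (a + j)       ≡⟨ bit-s a j ⟨
  bit j (s a)         ≡⟨ cong (bit j) s≡T ⟩
  bit j (T (suc c))   ≡⟨ bit-T j≤c ⟩
  1 ∸ bit j (c ∸ j)   ∎)
  where
  open ≡-Reasoning
  regroup : ∀ a j r → a + j + r + 1 ≡ suc (a + (j + r))
  regroup = solve-∀
  sum : a + j + (c ∸ j) + 1 ≡ suc (q * 2) * 2 ^ j
  sum = trans (regroup a j (c ∸ j)) (trans (cong (λ x → suc (a + x)) (m+[n∸m]≡n j≤c)) a+c+1≡)
... | no j≰c = 1+n≢0 (begin
  1                                       ≡⟨ [m+kn]%n≡m%n 1 q 2 ⟨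
  suc (q * 2) % 2                         ≡⟨ bit-low j (suc (q * 2)) r<2^j ⟨
  bit j (r + suc (q * 2) * 2 ^ j)         ≡⟨ cong (λ x → bit j (r + x)) a+c+1≡ ⟨
  bit j (r + suc (a + c))                 ≡⟨ cong (bit j) split ⟨
  bit j (a + j)                           ≡⟨ bit-s a j ⟨
  bit j (s a)                             ≡⟨ cong (bit j) s≡T ⟩
  bit j (T (suc c))                       ≡⟨ bit-T-> (≰⇒> j≰c) ⟩
  0                                       ∎)
  where
  open ≡-Reasoning
  r = j ∸ suc c
  r<2^j : r < 2 ^ j
  r<2^j = ≤-<-trans (m∸n≤m j (suc c)) (n<2^n j)
  regroup : ∀ a r c → a + (r + suc c) ≡ r + suc (a + c)
  regroup = solve-∀
  split : a + j ≡ r + suc (a + c)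
  split = trans (cong (_+_ a) (sym (m∸n+n≡m (≰⇒> j≰c)))) (regroup a r c)

Fin-injective⇒surjective : ∀ {n} (f : Fin n → Fin n) → Injective _≡_ _≡_ f → ∀ y → ∃ λ i → f i ≡ y
Fin-injective⇒surjective {suc n} f f-inj y with any? (λ i → f i Fin.≟ y)
... | yes hit = hit
... | no miss = contradiction (injective⇒≤ g-inj) 1+n≰n
  where
  avoids : ∀ i → y ≢ f i
  avoids i y≡fi = miss (i , sym y≡fi)
  g : Fin (suc n) → Fin n
  g i = punchOut (avoids i)
  g-inj : Injective _≡_ _≡_ g
  g-inj {i} {j} g≡ = f-inj (punchOut-injective (avoids i) (avoids j) g≡)

injective⇒surjective-below : ∀ n (f : ℕ → ℕ) → (∀ {i} → i < n → f i < n) → Injective _≡_ _≡_ f →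
                             ∀ {y} → y < n → ∃ λ i → f i ≡ y
injective⇒surjective-below n f f< f-inj {y} y<n =
  from-Fin (Fin-injective⇒surjective g g-inj (fromℕ< y<n))
  where
  open ≡-Reasoning
  g : Fin n → Fin n
  g i = fromℕ< (f< (toℕ<n i))
  toℕ-g : ∀ i → toℕ (g i) ≡ f (toℕ i)
  toℕ-g i = toℕ-fromℕ< (f< (toℕ<n i))
  g-inj : Injective _≡_ _≡_ g
  g-inj {i} {j} g≡ = toℕ-injective (f-inj (begin
    f (toℕ i)   ≡⟨ toℕ-g i ⟨
    toℕ (g i)   ≡⟨ cong toℕ g≡ ⟩
    toℕ (g j)   ≡⟨ toℕ-g j ⟩
    f (toℕ j)   ∎))
  from-Fin : (∃ λ i → g i ≡ fromℕ< y<n) → ∃ λ i → f i ≡ y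
  from-Fin (i , gi≡y) = toℕ i , (begin
    f (toℕ i)          ≡⟨ toℕ-g i ⟨
    toℕ (g i)          ≡⟨ cong toℕ gi≡y ⟩
    toℕ (fromℕ< y<n)   ≡⟨ toℕ-fromℕ< y<n ⟩
    y                  ∎)

-- window K lists T 1, …, T K and then s 0, s 1, …; it maps [0, 2^K) injectively into itself.
window : ℕ → ℕ → ℕ
window K i with i <? K
... | yes _ = T (suc i)
... | no  _ = s (i ∸ K)

window-< : ∀ {K i} → i < 2 ^ K → window K i < 2 ^ K
window-< {K} {i} i<2^K with i <? K
... | yes i<K = <-≤-trans (T<2^ i) (^-monoʳ-≤ 2 i<K)
... | no  i≮K = s<2^ {i ∸ K} {K} (subst (_< 2 ^ K) (sym (m∸n+n≡m (≮⇒≥ i≮K))) i<2^K)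

window-injective : ∀ {K} → Injective _≡_ _≡_ (window K)
window-injective {K} {i} {j} w≡ with i <? K | j <? K
... | yes _   | yes _   = T-injective w≡
... | yes _   | no  _   = contradiction (sym w≡) (s≢T (j ∸ K) i)
... | no  _   | yes _   = contradiction w≡ (s≢T (i ∸ K) j)
... | no  i≮K | no  j≮K = begin
  i              ≡⟨ m∸n+n≡m (≮⇒≥ i≮K) ⟨
  i ∸ K + K      ≡⟨ cong (_+ K) (s-injective w≡) ⟩
  j ∸ K + K      ≡⟨ m∸n+n≡m (≮⇒≥ j≮K) ⟩
  j              ∎
  where open ≡-Reasoning

s-or-T : ∀ N → (∃ λ a → s a ≡ N) ⊎ (∃ λ c → T (suc c) ≡ N)
s-or-T N = classify (injective⇒surjective-below (2 ^ N) (window N) (window-< {N}) (window-injective {N}) (n<2^n N))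
  where
  classify : (∃ λ i → window N i ≡ N) → (∃ λ a → s a ≡ N) ⊎ (∃ λ c → T (suc c) ≡ N)
  classify (i , hit) with i <? N
  ... | yes _ = inj₂ (i , hit)
  ... | no  _ = inj₁ (i ∸ N , hit)

T-isListing : IsListing T
T-isListing = T-step , λ m → missing⇒T m , T⇒missing m
  where
  missing⇒T : ∀ m → Missing m → ∃ λ k → 1 ≤ k × T k ≡ m
  missing⇒T m missing with s-or-T m
  ... | inj₁ hit     = contradiction hit missing
  ... | inj₂ (c , T≡) = suc c , s≤s z≤n , T≡
  T⇒missing : ∀ m → (∃ λ k → 1 ≤ k × T k ≡ m) → Missing m
  T⇒missing m (suc c , _ , T≡) (a , s≡) = s≢T a c (trans s≡ (sym T≡))

listing-≤ : ∀ {t t′} → IsListing t → IsListing t′ → ∀ {n} →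
            (∀ {m} → 1 ≤ m → m ≤ n → t m ≡ t′ m) → t′ (suc n) ≤ t (suc n)
listing-≤ (t-step , t-image) (t′-step , t′-image) {n} agree
  with k , 1≤k , t′k≡ ← proj₁ (t′-image _) (proj₂ (t-image _) (suc n , s≤s z≤n , refl)) with k ≤? n
... | yes k≤n =
  contradiction (trans (agree 1≤k k≤n) t′k≡) (<⇒≢ (step⇒strictly-increasing t-step 1≤k (s≤s k≤n)))
... | no  k≰n with m≤n⇒m<n∨m≡n (≰⇒> k≰n)
...   | inj₁ n+1<k =
  ≤-trans (<⇒≤ (step⇒strictly-increasing t′-step (s≤s z≤n) n+1<k)) (≤-reflexive t′k≡)
...   | inj₂ refl  = ≤-reflexive t′k≡

listings-agree : ∀ {t t′} → IsListing t → IsListing t′ → ∀ n {m} → 1 ≤ m → m ≤ n → t m ≡ t′ m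
listings-agree L L′ zero    1≤m m≤0 = contradiction (≤-trans 1≤m m≤0) λ ()
listings-agree L L′ (suc n) 1≤m m≤n+1 with m≤n⇒m<n∨m≡n m≤n+1
... | inj₁ (s≤s m≤n) = listings-agree L L′ n 1≤m m≤n
... | inj₂ refl      = ≤-antisym (listing-≤ L′ L (λ 1≤k k≤n → sym (listings-agree L L′ n 1≤k k≤n)))
                                 (listing-≤ L L′ (listings-agree L L′ n))

listing-unique : ∀ {t t′} → IsListing t → IsListing t′ → ∀ {n} → 1 ≤ n → t n ≡ t′ n
listing-unique L L′ {n} 1≤n = listings-agree L L′ n 1≤n ≤-refl

-- The sums of the powers 2^k with 2^k ∣ n − k

divTermℕ : ℕ → ℕ → ℕ
divTermℕ m k = if ⌊ 2 ^ k ∣? m ⌋ then 2 ^ k else 0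

divTermℕ-yes : ∀ k {m} → 2 ^ k ∣ m → divTermℕ m k ≡ 2 ^ k
divTermℕ-yes k {m} 2^k∣m with 2 ^ k ∣? m
... | yes _    = refl
... | no 2^k∤m = contradiction 2^k∣m 2^k∤m

divTermℕ-no : ∀ k {m} → ¬ 2 ^ k ∣ m → divTermℕ m k ≡ 0
divTermℕ-no k {m} 2^k∤m with 2 ^ k ∣? m
... | yes 2^k∣m = contradiction 2^k∣m 2^k∤m
... | no _      = refl

divTermℕ-small : ∀ k {x} → 0 < x → x < 2 ^ k → divTermℕ x k ≡ 0
divTermℕ-small k 0<x x<2^k = divTermℕ-no k (λ 2^k∣x → <⇒≱ x<2^k (∣⇒≤ {{ℕ.>-nonZero 0<x}} 2^k∣x))

divTermℕ-shift : ∀ {k i} x → k ≤ i → divTermℕ (2 ^ i + x) k ≡ divTermℕ x k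
divTermℕ-shift {k} {i} x k≤i with 2 ^ k ∣? x
... | yes 2^k∣x = divTermℕ-yes k (∣m∣n⇒∣m+n (^-monoʳ-∣ 2 k≤i) 2^k∣x)
... | no  2^k∤x = divTermℕ-no k (λ 2^k∣ → 2^k∤x (∣m+n∣m⇒∣n 2^k∣ (^-monoʳ-∣ 2 k≤i)))

%2^-suc+divTermℕ : ∀ k y → suc y %2^ k + divTermℕ (suc y) k ≡ suc (y %2^ k)
%2^-suc+divTermℕ k y with suc (y %2^ k) <? 2 ^ k
... | yes r+1<2^k = begin
  suc y %2^ k + divTermℕ (suc y) k   ≡⟨ cong₂ _+_ remainder (divTermℕ-no k 2^k∤) ⟩
  suc (y %2^ k) + 0                  ≡⟨ +-identityʳ _ ⟩
  suc (y %2^ k)                      ∎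
  where
  open ≡-Reasoning
  instance _ = 2^-nonZero k
  remainder : suc y %2^ k ≡ suc (y %2^ k)
  remainder = begin
    suc y % 2 ^ k                              ≡⟨ cong (λ z → suc z % 2 ^ k) (m≡m%n+[m/n]*n y (2 ^ k)) ⟩
    (suc (y %2^ k) + y /2^ k * 2 ^ k) % 2 ^ k  ≡⟨ [m+kn]%n≡m%n (suc (y %2^ k)) (y /2^ k) (2 ^ k) ⟩
    suc (y %2^ k) % 2 ^ k                      ≡⟨ m<n⇒m%n≡m r+1<2^k ⟩
    suc (y %2^ k)                              ∎
  2^k∤ : ¬ 2 ^ k ∣ suc y
  2^k∤ 2^k∣ = 1+n≢0 (trans (sym remainder) (n∣m⇒m%n≡0 (suc y) (2 ^ k) 2^k∣))
... | no r+1≮2^k = begin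
  suc y %2^ k + divTermℕ (suc y) k   ≡⟨ cong₂ _+_ (trans (cong (_% 2 ^ k) multiple) (m*n%n≡0 (suc (y /2^ k)) (2 ^ k)))
                                                  (divTermℕ-yes k (divides (suc (y /2^ k)) multiple)) ⟩
  2 ^ k                              ≡⟨ r+1≡2^k ⟨
  suc (y %2^ k)                      ∎
  where
  open ≡-Reasoning
  instance _ = 2^-nonZero k
  r+1≡2^k : suc (y %2^ k) ≡ 2 ^ k
  r+1≡2^k = ≤-antisym (m%n<n y (2 ^ k)) (≮⇒≥ r+1≮2^k)
  multiple : suc y ≡ suc (y /2^ k) * 2 ^ k
  multiple = begin
    suc y                                  ≡⟨ cong suc (m≡m%n+[m/n]*n y (2 ^ k)) ⟩
    suc (y %2^ k) + y /2^ k * 2 ^ k        ≡⟨ cong (λ r → r + y /2^ k * 2 ^ k) r+1≡2^k ⟩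
    suc (y /2^ k) * 2 ^ k                  ∎

sum1ℕ : ℕ → (ℕ → ℕ) → ℕ
sum1ℕ zero    f = 0
sum1ℕ (suc n) f = sum1ℕ n f + f (suc n)

sum1ℕ-cong-≤ : ∀ n {f g} → (∀ k → k ≤ n → f k ≡ g k) → sum1ℕ n f ≡ sum1ℕ n g
sum1ℕ-cong-≤ zero    _   = refl
sum1ℕ-cong-≤ (suc n) f≗g =
  cong₂ _+_ (sum1ℕ-cong-≤ n (λ k k≤n → f≗g k (m≤n⇒m≤1+n k≤n))) (f≗g (suc n) ≤-refl)

sum1ℕ-vanishing : ∀ {i m f} → i ≤ m → (∀ k → i < k → k ≤ m → f k ≡ 0) → sum1ℕ m f ≡ sum1ℕ i f
sum1ℕ-vanishing {i} {m} i≤m vanish with m≤n⇒m<n∨m≡n i≤m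
... | inj₂ refl = refl
sum1ℕ-vanishing {i} {suc m} {f} _ vanish | inj₁ (s≤s i≤m) = begin
  sum1ℕ m f + f (suc m)   ≡⟨ cong₂ _+_ (sum1ℕ-vanishing i≤m (λ k i<k k≤m → vanish k i<k (m≤n⇒m≤1+n k≤m)))
                                       (vanish (suc m) (s≤s i≤m) ≤-refl) ⟩
  sum1ℕ i f + 0           ≡⟨ +-identityʳ _ ⟩
  sum1ℕ i f               ∎
  where open ≡-Reasoning

-- (iii) says that t n = D n − n.
D : ℕ → ℕ
D n = sum1ℕ n (λ k → divTermℕ (n ∸ k) k)

D-suc : ∀ m → D (suc m) ≡ sum1ℕ m (λ k → divTermℕ (suc m ∸ k) k) + 2 ^ suc m
D-suc m = cong (_+_ (sum1ℕ m (λ k → divTermℕ (suc m ∸ k) k)))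
               (trans (cong (λ x → divTermℕ x (suc m)) (n∸n≡0 m)) (divTermℕ-yes (suc m) (divides 0 refl)))

T+d+1≡2^ : ∀ c → T (suc c) + d c + 1 ≡ 2 ^ suc c
T+d+1≡2^ c = numeral-complement (λ k → bit≤1 k (c ∸ k)) c

-- The carry invariant; at K = c it says d c + (D (suc c) − 2^(c+1)) = c.
d-partial : ∀ c K → K ≤ c →
            sumℕ K (λ k → bit k (c ∸ k) * 2 ^ k) + sum1ℕ K (λ k → divTermℕ (suc c ∸ k) k)
            ≡ K + (c ∸ K) %2^ suc K
d-partial c zero    _   = begin
  bit 0 c * 1 + 0               ≡⟨ +-identityʳ _ ⟩
  bit 0 c * 1                   ≡⟨ cong (_+ bit 0 c * 1) (n%1≡0 c) ⟨
  c %2^ 0 + bit 0 c * 2 ^ 0     ≡⟨ %2^-suc 0 c ⟨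
  c %2^ 1                       ∎
  where open ≡-Reasoning
d-partial c (suc K) K<c = begin
  A + b * P + (B + g)                  ≡⟨ regroup A B g (b * P) ⟩
  A + B + g + b * P                    ≡⟨ cong (λ x → x + g + b * P) (d-partial c K (<⇒≤ K<c)) ⟩
  K + (c ∸ K) %2^ suc K + g + b * P    ≡⟨ cong (_+ b * P) (+-assoc K _ _) ⟩
  K + carry (c ∸ K) + b * P            ≡⟨ cong (λ z → K + carry z + b * P) c∸K≡ ⟩
  K + carry (suc y) + b * P            ≡⟨ cong (λ x → K + x + b * P) (%2^-suc+divTermℕ (suc K) y) ⟩
  K + suc (y %2^ suc K) + b * P        ≡⟨ regroup′ K (y %2^ suc K) (b * P) ⟩
  suc K + (y %2^ suc K + b * P)        ≡⟨ cong (_+_ (suc K)) (%2^-suc (suc K) y) ⟨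
  suc K + y %2^ suc (suc K)            ∎
  where
  open ≡-Reasoning
  y = c ∸ suc K
  A = sumℕ K (λ k → bit k (c ∸ k) * 2 ^ k)
  B = sum1ℕ K (λ k → divTermℕ (suc c ∸ k) k)
  b = bit (suc K) y
  P = 2 ^ suc K
  g = divTermℕ (c ∸ K) (suc K)
  carry : ℕ → ℕ
  carry z = z %2^ suc K + divTermℕ z (suc K)
  c∸K≡ : c ∸ K ≡ suc y
  c∸K≡ = +-∸-assoc 1 K<c
  regroup : ∀ a b g u → a + u + (b + g) ≡ a + b + g + u
  regroup = solve-∀
  regroup′ : ∀ k r u → k + suc r + u ≡ suc k + (r + u)
  regroup′ = solve-∀

d+sum1ℕ : ∀ c → d c + sum1ℕ c (λ k → divTermℕ (suc c ∸ k) k) ≡ c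
d+sum1ℕ c = begin
  d c + sum1ℕ c (λ k → divTermℕ (suc c ∸ k) k)   ≡⟨ d-partial c c ≤-refl ⟩
  c + (c ∸ c) %2^ suc c                           ≡⟨ cong (λ x → c + x %2^ suc c) (n∸n≡0 c) ⟩
  c + 0 %2^ suc c                                 ≡⟨ cong (_+_ c) (m<n⇒m%n≡m (m^n>0 2 (suc c))) ⟩
  c + 0                                           ≡⟨ +-identityʳ c ⟩
  c                                               ∎
  where
  open ≡-Reasoning
  instance _ = 2^-nonZero (suc c)

T+n≡D : ∀ c → T (suc c) + suc c ≡ D (suc c)
T+n≡D c = begin
  T (suc c) + suc c            ≡⟨ cong (λ x → T (suc c) + suc x) (d+sum1ℕ c) ⟨
  T (suc c) + suc (d c + G)    ≡⟨ regroup (T (suc c)) (d c) G ⟩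
  T (suc c) + d c + 1 + G      ≡⟨ cong (_+ G) (T+d+1≡2^ c) ⟩
  2 ^ suc c + G                ≡⟨ +-comm (2 ^ suc c) G ⟩
  G + 2 ^ suc c                ≡⟨ D-suc c ⟨
  D (suc c)                    ∎
  where
  open ≡-Reasoning
  G = sum1ℕ c (λ k → divTermℕ (suc c ∸ k) k)
  regroup : ∀ t d g → t + suc (d + g) ≡ t + d + 1 + g
  regroup = solve-∀

D-truncate : ∀ {i n} → i < n → n ≤ 2 ^ suc i + i → D n ≡ sum1ℕ i (λ k → divTermℕ (n ∸ k) k) + 2 ^ n
D-truncate {i} {suc m} (s≤s i≤m) n≤ = trans (D-suc m) (cong (_+ 2 ^ suc m) (sum1ℕ-vanishing i≤m vanish))
  where
  vanish : ∀ k → i < k → k ≤ m → divTermℕ (suc m ∸ k) k ≡ 0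
  vanish k i<k k≤m = divTermℕ-small k (m<n⇒0<n∸m (s≤s k≤m)) (m<n+o⇒m∸n<o (suc m) k (begin-strict
    suc m          ≤⟨ n≤ ⟩
    2 ^ suc i + i  <⟨ +-mono-≤-< (^-monoʳ-≤ 2 i<k) i<k ⟩
    2 ^ k + k      ≡⟨ +-comm (2 ^ k) k ⟩
    k + 2 ^ k      ∎))
    where
    open ≤-Reasoning
    instance _ = 2^-nonZero k

D-low-shift : ∀ {i j} → i ≤ j →
              sum1ℕ i (λ k → divTermℕ (2 ^ i + j ∸ k) k) ≡ sum1ℕ i (λ k → divTermℕ (j ∸ k) k)
D-low-shift {i} {j} i≤j = sum1ℕ-cong-≤ i λ k k≤i →
  trans (cong (λ x → divTermℕ x k) (+-∸-assoc (2 ^ i) (≤-trans k≤i i≤j))) (divTermℕ-shift (j ∸ k) k≤i)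

2^i+[2^i+i]≡2^[1+i]+i : ∀ i → 2 ^ i + (2 ^ i + i) ≡ 2 ^ suc i + i
2^i+[2^i+i]≡2^[1+i]+i i =
  trans (sym (+-assoc (2 ^ i) (2 ^ i) i)) (cong (λ x → 2 ^ i + x + i) (sym (+-identityʳ (2 ^ i))))

D-2^i+i : ∀ i → D (2 ^ i + i) ≡ D i + 2 ^ (2 ^ i + i)
D-2^i+i i = trans (D-truncate (m<n+m i (m^n>0 2 i)) (+-monoˡ-≤ i (^-monoʳ-≤ 2 (n≤1+n i))))
                  (cong (_+ 2 ^ (2 ^ i + i)) (D-low-shift {i} ≤-refl))

D-2^i+j : ∀ {i j} → i < j → j ≤ 2 ^ i + i → D (2 ^ i + j) + 2 ^ j ≡ 2 ^ (2 ^ i + j) + D j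
D-2^i+j {i} {j} i<j j≤ = begin
  D n + 2 ^ j                                  ≡⟨ cong (_+ 2 ^ j) (D-truncate i<n n≤) ⟩
  sum1ℕ i (λ k → divTermℕ (n ∸ k) k) + 2 ^ n + 2 ^ j
                                               ≡⟨ cong (λ x → x + 2 ^ n + 2 ^ j) (D-low-shift (<⇒≤ i<j)) ⟩
  L + 2 ^ n + 2 ^ j                            ≡⟨ regroup L (2 ^ n) (2 ^ j) ⟩
  2 ^ n + (L + 2 ^ j)                          ≡⟨ cong (_+_ (2 ^ n)) (D-truncate i<j j≤′) ⟨
  2 ^ n + D j                                  ∎
  where
  open ≡-Reasoning
  n = 2 ^ i + j
  L = sum1ℕ i (λ k → divTermℕ (j ∸ k) k)
  i<n : i < n
  i<n = <-≤-trans i<j (m≤n+m j (2 ^ i))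
  n≤ : n ≤ 2 ^ suc i + i
  n≤ = subst (n ≤_) (2^i+[2^i+i]≡2^[1+i]+i i) (+-monoʳ-≤ (2 ^ i) j≤)
  j≤′ : j ≤ 2 ^ suc i + i
  j≤′ = ≤-trans j≤ (+-monoˡ-≤ i (^-monoʳ-≤ 2 (n≤1+n i)))
  regroup : ∀ l a b → l + a + b ≡ a + (l + b)
  regroup = solve-∀

sum0-cong : ∀ n {f g : ℕ → ℤ} → (∀ k → f k ≡ g k) → sum0 n f ≡ sum0 n g
sum0-cong zero    f≗g = f≗g 0
sum0-cong (suc n) f≗g = cong₂ ℤ._+_ (sum0-cong n f≗g) (f≗g (suc n))

sum0-diff : ∀ n f g → sum0 n (λ k → + f k - + g k) ≡ + sumℕ n f - + sumℕ n g
sum0-diff zero    f g = refl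
sum0-diff (suc n) f g = begin
  sum0 n (λ k → + f k - + g k) ℤ.+ (+ a - + b)   ≡⟨ cong (ℤ._+ (+ a - + b)) (sum0-diff n f g) ⟩
  + F - + G ℤ.+ (+ a - + b)                      ≡⟨ regroup (+ F) (+ G) (+ a) (+ b) ⟩
  (+ F ℤ.+ + a) - (+ G ℤ.+ + b)                  ≡⟨ cong₂ _-_ (ℤ.pos-+ F a) (ℤ.pos-+ G b) ⟨
  + (F + a) - + (G + b)                          ∎
  where
  open ≡-Reasoning
  F = sumℕ n f
  G = sumℕ n g
  a = f (suc n)
  b = g (suc n)
  regroup : ∀ x y u v → x - y ℤ.+ (u - v) ≡ (x ℤ.+ u) - (y ℤ.+ v)
  regroup = ℤ-Solver.solve-∀

sum1-cong-≤ : ∀ n {f g : ℕ → ℤ} → (∀ k → k ≤ n → f k ≡ g k) → sum1 n f ≡ sum1 n g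
sum1-cong-≤ zero    _   = refl
sum1-cong-≤ (suc n) f≗g =
  cong₂ ℤ._+_ (sum1-cong-≤ n (λ k k≤n → f≗g k (m≤n⇒m≤1+n k≤n))) (f≗g (suc n) ≤-refl)

sum1-pos : ∀ n f → sum1 n (λ k → + f k) ≡ + sum1ℕ n f
sum1-pos zero    f = refl
sum1-pos (suc n) f = trans (cong (ℤ._+ + f (suc n)) (sum1-pos n f)) (sym (ℤ.pos-+ (sum1ℕ n f) (f (suc n))))

divTerm≡+divTermℕ : ∀ x k → divTerm x k ≡ + divTermℕ ∣ x ∣ k
divTerm≡+divTermℕ x k with ⌊ 2 ^ k ∣? ∣ x ∣ ⌋
... | true  = refl
... | false = refl

sum1-divTerm : ∀ n (x : ℕ → ℤ) → (∀ k → k ≤ n → ∣ x k ∣ ≡ n ∸ k) →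
               sum1 n (λ k → divTerm (x k) k) ≡ + D n
sum1-divTerm n x ∣x∣≡ = trans (sum1-cong-≤ n term) (sum1-pos n (λ k → divTermℕ (n ∸ k) k))
  where
  term : ∀ k → k ≤ n → divTerm (x k) k ≡ + divTermℕ (n ∸ k) k
  term k k≤n = trans (divTerm≡+divTermℕ (x k) k) (cong (λ m → + divTermℕ m k) (∣x∣≡ k k≤n))

pow2≡T+d+1 : ∀ c → pow2 (suc c) ≡ + T (suc c) ℤ.+ + d c ℤ.+ + 1
pow2≡T+d+1 c = begin
  + (2 ^ suc c)                        ≡⟨ cong +_ (T+d+1≡2^ c) ⟨
  + (T (suc c) + d c + 1)              ≡⟨ ℤ.pos-+ (T (suc c) + d c) 1 ⟩
  + (T (suc c) + d c) ℤ.+ + 1          ≡⟨ cong (ℤ._+ + 1) (ℤ.pos-+ (T (suc c)) (d c)) ⟩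
  + T (suc c) ℤ.+ + d c ℤ.+ + 1        ∎
  where open ≡-Reasoning

signedTerm-digits : ∀ n k → signedTerm n k ≡ + ((1 ∸ bit k (n ∸ k)) * 2 ^ k) - + (bit k (n ∸ k) * 2 ^ k)
signedTerm-digits n k with 2 ∣? (n ∸ k) /2^ k
... | yes 2∣x rewrite bit k (n ∸ k) ≡ 0 ∋ n∣m⇒m%n≡0 _ 2 2∣x =
  cong +_ (sym (trans (+-identityʳ _) (+-identityʳ _)))
... | no 2∤x rewrite bit k (n ∸ k) ≡ 1 ∋ 2∤n⇒n%2≡1 _ 2∤x =
  sym (trans (ℤ.+-identityˡ _) (cong (λ x → - + x) (+-identityʳ _)))

T-i : ∀ n → + 2 ℤ.* + T (suc n) ≡ pow2 (suc n) - + 1 ℤ.+ sum0 n (signedTerm n)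
T-i n = begin
  + 2 ℤ.* + T (suc n)                              ≡⟨ double (+ T (suc n)) (+ d n) ⟩
  (+ T (suc n) ℤ.+ + d n ℤ.+ + 1) - + 1 ℤ.+ (+ T (suc n) - + d n)
                                                   ≡⟨ cong₂ (λ p σ → p - + 1 ℤ.+ σ) (pow2≡T+d+1 n) signed-sum ⟨
  pow2 (suc n) - + 1 ℤ.+ sum0 n (signedTerm n)     ∎
  where
  open ≡-Reasoning
  double : ∀ t δ → + 2 ℤ.* t ≡ (t ℤ.+ δ ℤ.+ + 1) - + 1 ℤ.+ (t - δ)
  double = ℤ-Solver.solve-∀
  signed-sum : sum0 n (signedTerm n) ≡ + T (suc n) - + d n
  signed-sum = trans (sum0-cong n (signedTerm-digits n)) (sum0-diff n _ _)

T-iv : ∀ n → 1 ≤ n → + T n ≡ pow2 n - + 1 - + d (n ∸ 1)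
T-iv (suc c) _ = trans (cancel (+ T (suc c)) (+ d c)) (cong (λ x → x - + 1 - + d c) (sym (pow2≡T+d+1 c)))
  where
  cancel : ∀ t δ → t ≡ t ℤ.+ δ ℤ.+ + 1 - + 1 - δ
  cancel = ℤ-Solver.solve-∀

+T≡+D-n : ∀ n → 1 ≤ n → + T n ≡ + D n - + n
+T≡+D-n (suc c) _ = begin
  + T (suc c)                        ≡⟨ cancel (+ T (suc c)) (+ suc c) ⟩
  + T (suc c) ℤ.+ + suc c - + suc c  ≡⟨ cong (_- + suc c) (ℤ.pos-+ (T (suc c)) (suc c)) ⟨
  + (T (suc c) + suc c) - + suc c    ≡⟨ cong (λ x → + x - + suc c) (T+n≡D c) ⟩
  + D (suc c) - + suc c              ∎
  where
  open ≡-Reasoning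
  cancel : ∀ t n → t ≡ t ℤ.+ n - n
  cancel = ℤ-Solver.solve-∀

+T≡-n+D : ∀ n → 1 ≤ n → + T n ≡ - + n ℤ.+ + D n
+T≡-n+D n 1≤n = trans (+T≡+D-n n 1≤n) (ℤ.+-comm (+ D n) (- + n))

T-iii : ∀ n → 1 ≤ n → + T n ≡ - + n ℤ.+ sum1 n (λ k → divTerm (+ n - + k) k)
T-iii n 1≤n =
  trans (+T≡-n+D n 1≤n) (cong (ℤ._+_ (- + n)) (sym (sum1-divTerm n (λ k → + n - + k) ∣n-k∣≡)))
  where
  ∣n-k∣≡ : ∀ k → k ≤ n → ∣ + n - + k ∣ ≡ n ∸ k
  ∣n-k∣≡ k k≤n = trans (cong ∣_∣ (ℤ.m-n≡m⊖n n k))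
                       (trans (ℤ.∣m⊖n∣≡∣n⊖m∣ n k) (ℤ.∣⊖∣-≤ k≤n))

T-v : ∀ n → 1 ≤ n → + T n ≡ sExt (- + n)
T-v n@(suc _) 1≤n =
  trans (+T≡-n+D n 1≤n) (cong (ℤ._+_ (- + n)) (sym (sum1-divTerm n (λ k → - + n ℤ.+ + k) ∣-n+k∣≡)))
  where
  ∣-n+k∣≡ : ∀ k → k ≤ n → ∣ - + n ℤ.+ + k ∣ ≡ n ∸ k
  ∣-n+k∣≡ k k≤n = trans (cong ∣_∣ (ℤ.-m+n≡n⊖m n k)) (ℤ.∣⊖∣-≤ k≤n)

T-ii-diagonal : ∀ i → 1 ≤ i → + T (2 ^ i + i) ≡ pow2 (2 ^ i + i) - pow2 i ℤ.+ + T i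
T-ii-diagonal i 1≤i = begin
  + T n                                      ≡⟨ +T≡+D-n n (≤-trans 1≤i (m≤n+m i (2 ^ i))) ⟩
  + D n - + n                                ≡⟨ cong₂ _-_ (trans (cong +_ (D-2^i+i i)) (ℤ.pos-+ (D i) (2 ^ n)))
                                                          (ℤ.pos-+ (2 ^ i) i) ⟩
  (+ D i ℤ.+ pow2 n) - (pow2 i ℤ.+ + i)      ≡⟨ regroup (+ D i) (pow2 n) (pow2 i) (+ i) ⟩
  pow2 n - pow2 i ℤ.+ (+ D i - + i)          ≡⟨ cong (ℤ._+_ (pow2 n - pow2 i)) (+T≡+D-n i 1≤i) ⟨
  pow2 n - pow2 i ℤ.+ + T i                  ∎
  where
  open ≡-Reasoning
  n = 2 ^ i + i
  regroup : ∀ δ p q m → (δ ℤ.+ p) - (q ℤ.+ m) ≡ p - q ℤ.+ (δ - m)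
  regroup = ℤ-Solver.solve-∀

T-ii-above : ∀ {i j} → 1 ≤ i → i < j → j ≤ 2 ^ i + i →
             + T (2 ^ i + j) ≡ pow2 (2 ^ i + j) - pow2 i - pow2 j ℤ.+ + T j
T-ii-above {i} {j} 1≤i i<j j≤ = begin
  + T n                                            ≡⟨ +T≡+D-n n (≤-trans 1≤j (m≤n+m j (2 ^ i))) ⟩
  + D n - + n                                      ≡⟨ cong₂ _-_ +Dn≡ (ℤ.pos-+ (2 ^ i) j) ⟩
  pow2 n ℤ.+ + D j - pow2 j - (pow2 i ℤ.+ + j)     ≡⟨ regroup (pow2 n) (+ D j) (pow2 j) (pow2 i) (+ j) ⟩
  pow2 n - pow2 i - pow2 j ℤ.+ (+ D j - + j)       ≡⟨ cong (ℤ._+_ (pow2 n - pow2 i - pow2 j)) (+T≡+D-n j 1≤j) ⟨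
  pow2 n - pow2 i - pow2 j ℤ.+ + T j               ∎
  where
  open ≡-Reasoning
  n = 2 ^ i + j
  1≤j = ≤-trans 1≤i (<⇒≤ i<j)
  cancel : ∀ δ p → δ ≡ δ ℤ.+ p - p
  cancel = ℤ-Solver.solve-∀
  +Dn≡ : + D n ≡ pow2 n ℤ.+ + D j - pow2 j
  +Dn≡ = begin
    + D n                            ≡⟨ cancel (+ D n) (pow2 j) ⟩
    + D n ℤ.+ pow2 j - pow2 j        ≡⟨ cong (_- pow2 j) (ℤ.pos-+ (D n) (2 ^ j)) ⟨
    + (D n + 2 ^ j) - pow2 j         ≡⟨ cong (λ x → + x - pow2 j) (D-2^i+j i<j j≤) ⟩
    + (2 ^ n + D j) - pow2 j         ≡⟨ cong (_- pow2 j) (ℤ.pos-+ (2 ^ n) (D j)) ⟩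
    pow2 n ℤ.+ + D j - pow2 j        ∎
  regroup : ∀ p δ q r m → p ℤ.+ δ - q - (r ℤ.+ m) ≡ p - r - q ℤ.+ (δ - m)
  regroup = ℤ-Solver.solve-∀

theorem3 :
    Σ (ℕ → ℕ) IsListing ×
    ((t : ℕ → ℕ) → IsListing t →
      -- (i)  2 t(n+1) = 2^{n+1} - 1 + Σ_{k=0}^{n} (-1)^{⌊(n-k)/2^k⌋} 2^k
      ((n : ℕ) → + 2 ℤ.* + t (suc n) ≡ pow2 (suc n) - + 1 ℤ.+ sum0 n (signedTerm n)) ×
      -- (ii)
      (t 1 ≡ 1 × t 2 ≡ 2 ×
       ((i j : ℕ) → 1 ≤ i → i ≤ j → j ≤ 2 ^ i ℕ.+ i →
         (j ≡ i → + t (2 ^ i ℕ.+ j) ≡ pow2 (2 ^ i ℕ.+ i) - pow2 i ℤ.+ + t i) ×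
         (i < j → + t (2 ^ i ℕ.+ j) ≡ pow2 (2 ^ i ℕ.+ j) - pow2 i - pow2 j ℤ.+ + t j))) ×
      -- (iii)  t(n) = -n + Σ_{k≥1, 2^k ∣ n-k} 2^k
      ((n : ℕ) → 1 ≤ n → + t n ≡ - + n ℤ.+ sum1 n (λ k → divTerm (+ n - + k) k)) ×
      -- (iv)  t(n) = 2^n - 1 - d(n-1)
      ((n : ℕ) → 1 ≤ n → + t n ≡ pow2 n - + 1 - + d (n ℕ.∸ 1)) ×
      -- (v)  t(n) = s(-n)
      ((n : ℕ) → 1 ≤ n → + t n ≡ sExt (- + n)))
theorem3 = (T , T-isListing) , λ t L →
  let t≡T : ∀ {n} → 1 ≤ n → t n ≡ T n
      t≡T = listing-unique L T-isListing
      via-T : ∀ {n m} (F : ℤ → ℤ) → 1 ≤ n → 1 ≤ m → + T n ≡ F (+ T m) → + t n ≡ F (+ t m)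
      via-T F 1≤n 1≤m eq = trans (cong +_ (t≡T 1≤n)) (trans eq (cong (λ x → F (+ x)) (sym (t≡T 1≤m))))
      via-T′ : ∀ {n} {x : ℤ} → 1 ≤ n → + T n ≡ x → + t n ≡ x
      via-T′ 1≤n = trans (cong +_ (t≡T 1≤n))
  in (λ n → trans (cong (λ x → + 2 ℤ.* + x) (t≡T (s≤s z≤n))) (T-i n))
   , ( t≡T (s≤s z≤n) , t≡T (s≤s z≤n)
     , λ i j 1≤i i≤j j≤ →
         (λ { refl → via-T (ℤ._+_ (pow2 (2 ^ i + i) - pow2 i)) (≤-trans 1≤i (m≤n+m i (2 ^ i))) 1≤i
                           (T-ii-diagonal i 1≤i) })
       , λ i<j → via-T (ℤ._+_ (pow2 (2 ^ i + j) - pow2 i - pow2 j))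
                       (≤-trans (≤-trans 1≤i i≤j) (m≤n+m j (2 ^ i))) (≤-trans 1≤i i≤j)
                       (T-ii-above 1≤i i<j j≤))
   , (λ n 1≤n → via-T′ 1≤n (T-iii n 1≤n))
   , (λ n 1≤n → via-T′ 1≤n (T-iv n 1≤n))
   , (λ n 1≤n → via-T′ 1≤n (T-v n 1≤n))
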